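{- Let $G\in\mathcal{G}$, with cliques on $X=\{x_1,\ldots,x_m\}$ and $Y=\{y_1,\ldots,y_n\}$ ($n\ge m$), be such that at most $n-m$ vertices of $Y$ have a neighbour in $X$. If $G$ is connected and either $n$ or $m$ is even, then $T_2(G)$ is not well-covered.
   Context: $\mathcal{G}$ is the class of graphs obtained by taking the disjoint union of a complete graph $K_m$ with vertex set $X=\{x_1,\ldots,x_m\}$ and a complete graph $K_n$ with vertex set $Y=\{y_1,\ldots,y_n\}$, where $n\geq m$, and then adding some (possibly no) edges each joining a vertex of $X$ to a vertex of $Y$. The $2$-token graph $T_2(G)$ has as vertices the $2$-subsets of $V(G)$, two of them adjacent if their symmetric difference is an edge of $G$. A graph is well-covered if all of its maximal (with respect to inclusion) independent sets have the same cardinality. -}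

module Defs where

open import Data.Nat using (ℕ; _≤_; _∸_)
open import Data.Fin using (Fin) renaming (_<_ to _<ᶠ_)
open import Data.Sum using (_⊎_; inj₁; inj₂)
open import Data.Product using (Σ; _×_; _,_; proj₁; proj₂; ∃-syntax)
open import Data.Bool using (Bool; true; false)
open import Data.Unit using (⊤)
open import Data.Empty using (⊥)
open import Data.List using (List; _∷_; length; filterᵇ; allFin)
open import Data.Bool.ListAction using (any)
open import Data.List.Membership.Propositional using (_∈_; _∉_)
open import Data.List.Relation.Unary.All using (All)
open import Data.List.Relation.Unary.Unique.Propositional using (Unique)
open import Relation.Binary.PropositionalEquality using (_≡_; _≢_)
open import Relation.Nullary using (¬_)
open import Function.Bundles using (_⇔_)

record Graph : Set₁ where
  field
    V : Set
    E : V → V → Set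

module _ (G : Graph) where
  open Graph G

  -- a finite vertex set is a duplicate-free list; its cardinality is its length
  Independent : List V → Set
  Independent I = Unique I × (∀ {u v} → u ∈ I → v ∈ I → ¬ E u v)

  MaximalIndependent : List V → Set
  MaximalIndependent I =
    Independent I × (∀ v → v ∉ I → ¬ Independent (v ∷ I))

  WellCovered : Set
  WellCovered = ∀ I J → MaximalIndependent I → MaximalIndependent J →
                length I ≡ length J

  data Walk : V → V → Set where
    here : ∀ {u} → Walk u u
    step : ∀ {u v w} → E u v → Walk v w → Walk u w

  Connected : Set
  Connected = ∀ u v → Walk u v

-- The class 𝒢: K_m on X = Fin m, K_n on Y = Fin n, cross edges given by B

VG : ℕ → ℕ → Set
VG m n = Fin m ⊎ Fin n

EG : ∀ {m n} → (Fin m → Fin n → Bool) → VG m n → VG m n → Set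
EG B (inj₁ a) (inj₁ a') = a ≢ a'
EG B (inj₂ b) (inj₂ b') = b ≢ b'
EG B (inj₁ a) (inj₂ b)  = B a b ≡ true
EG B (inj₂ b) (inj₁ a)  = B a b ≡ true

graphG : (m n : ℕ) → (Fin m → Fin n → Bool) → Graph
graphG m n B = record { V = VG m n ; E = EG B }

nbrCountY : ∀ {m n} → (Fin m → Fin n → Bool) → ℕ
nbrCountY {m} {n} B = length (filterᵇ (λ b → any (λ a → B a b) (allFin m)) (allFin n))

-- The 2-token graph of a graph whose vertex type carries a strict order.
-- A 2-subset {u,v} is represented uniquely as (u , v) with u ≺ v.

module _ (G : Graph) (_≺_ : Graph.V G → Graph.V G → Set) where
  open Graph G

  Token : Set
  Token = Σ (V × V) (λ p → proj₁ p ≺ proj₂ p)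

  _∈ₜ_ : V → Token → Set
  v ∈ₜ ((a , b) , _) = (v ≡ a) ⊎ (v ≡ b)

  InSymDiff : V → Token → Token → Set
  InSymDiff v s t = (v ∈ₜ s × ¬ (v ∈ₜ t)) ⊎ (v ∈ₜ t × ¬ (v ∈ₜ s))

  TokenAdj : Token → Token → Set
  TokenAdj s t = ∃[ u ] ∃[ w ] (E u w × (∀ v → InSymDiff v s t ⇔ ((v ≡ u) ⊎ (v ≡ w))))

  T₂ : Graph
  T₂ = record { V = Token ; E = TokenAdj }

_≺_ : ∀ {m n} → VG m n → VG m n → Set
inj₁ a ≺ inj₁ a' = a <ᶠ a'
inj₁ a ≺ inj₂ b  = ⊤
inj₂ b ≺ inj₁ a  = ⊥
inj₂ b ≺ inj₂ b' = b <ᶠ b'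

-- Fix an edge x_c y_z between X and Y (G is connected) and an injection w of X into the vertices
-- of Y without neighbours in X (by the hypothesis there are at least m of them). For an injection
-- f : X → Y and duplicate-free lists LX, LY, the tokens {x, f x} together with the tokens pairing
-- consecutive vertices of LX and of LY are m + ⌊|LX|/2⌋ + ⌊|LY|/2⌋ tokens. They are independent in
-- T₂(G) when f(LX) has no neighbours in X and no pair of LY joins some f x to a neighbour of x, and
-- maximal when moreover LX and LY have even length and any two vertices they leave out are
-- dominated through the tokens {x, f x}.
-- If m is odd (so n is even), the maximal set with f = w leaving out x_c, y_(w c) and y_z has one
-- token fewer than the independent set that matches x_c to y_z and pairs y_z with y_(w c).
-- If m is even, the maximal set leaving out x_a and x_c (a ≠ c) and matching x_a to y_z has one
-- X-pair fewer, and no more Y-pairs, than the independent set pairing all of X with f = w.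
-- Extending the larger set to a maximal one contradicts well-coveredness.
module Submission where

open import Defs
open import Data.Bool using (Bool; true; T)
open import Data.Bool.ListAction using (any)
import Data.Bool.Properties as Bool
open import Data.Empty using (⊥; ⊥-elim)
open import Data.Fin using (Fin; zero; suc; toℕ; fromℕ<; inject≤)
open import Data.Fin.Properties using (_≟_; toℕ-injective; toℕ-inject≤)
import Data.Fin.Properties as FinP
open import Data.List
  using (List; []; _∷_; _++_; map; length; allFin; filter; filterᵇ; lookup; concatMap; tabulate)
open import Data.List.Properties using (length-tabulate; length-map; length-++)
open import Data.List.Membership.Propositional using (_∈_; _∉_; lose)
open import Data.List.Membership.Propositional.Properties
  using ( ∈-allFin; ∈-map⁺; ∈-map⁻; ∈-tabulate⁺; ∈-tabulate⁻; ∈-filter⁺; ∈-filter⁻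
        ; ∈-++⁺ˡ; ∈-++⁺ʳ; ∈-++⁻; ∈-lookup; ∈-concatMap⁺)
open import Data.List.Membership.Propositional.Properties.WithK using (unique∧set⇒bag)
open import Data.List.Relation.Binary.BagAndSetEquality using (∼bag⇒↭)
open import Data.List.Relation.Binary.Permutation.Propositional.Properties using (↭-length)
open import Data.List.Relation.Binary.Subset.Propositional using (_⊆_)
open import Data.List.Relation.Unary.All as All using (All; []; _∷_)
import Data.List.Relation.Unary.All.Properties as AllP
open import Data.List.Relation.Unary.All.Properties using (¬Any⇒All¬)
open import Data.List.Relation.Unary.AllPairs as AllPairs using (AllPairs; []; _∷_)
import Data.List.Relation.Unary.AllPairs.Properties as AllPairsP
open import Data.List.Relation.Unary.Any as Any using (here; there; satisfied)
open import Data.List.Relation.Unary.Any.Properties using (any⁺)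
open import Data.List.Relation.Unary.Unique.Propositional using (Unique)
import Data.List.Relation.Unary.Unique.Propositional.Properties as Unique
open import Data.Nat using (ℕ; suc; _+_; _∸_; _≤_; _<_; s≤s; ⌊_/2⌋; parity)
open import Data.Nat.Divisibility using (_∣_; divides)
open import Data.Nat.Properties
  using ( ≤-refl; ≤-reflexive; ≤-trans; n≤1+n; n<1+n; <-irrefl; +-suc; +-cancelˡ-≤; +-monoˡ-≤
        ; +-monoʳ-≤; +-monoʳ-<; m∸n+n≡m; ⌊n/2⌋-mono; module ≤-Reasoning)
open import Data.Parity using (0ℙ; 1ℙ; _⁻¹)
open import Data.Parity.Properties using (suc-homo-⁻¹; *-homo-*; *-zeroʳ)
open import Data.Product using (∃-syntax; _×_; _,_; proj₁; proj₂)
open import Data.Sum as Sum using (_⊎_; inj₁; inj₂; [_,_]; swap; reduce)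
open import Data.Sum.Properties using (inj₁-injective; inj₂-injective)
open import Data.Unit using (tt)
open import Data.Vec.Functional using (updateAt)
open import Data.Vec.Functional.Properties using (updateAt-updates; updateAt-minimal)
open import Function using (_∘_)
open import Function.Bundles using (_⇔_; mk⇔; Equivalence)
open import Relation.Binary.Definitions
  using (Irrelevant; Irreflexive; Transitive; Trichotomous; tri<; tri≈; tri>)
open import Relation.Binary.PropositionalEquality
  using ( _≡_; _≢_; refl; sym; trans; cong; cong₂; subst; subst₂; isEquivalence; resp₂
        ; module ≡-Reasoning)
open import Relation.Binary.Structures using (IsStrictTotalOrder)
open import Relation.Nullary using (¬_; Dec; yes; no; ¬?; _×-dec_; _⊎-dec_; _→-dec_)
open import Relation.Nullary.Decidable using (T?)
import Relation.Nullary.Decidable as Dec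

module _ {A : Set} where

  unique-∷ : ∀ {x : A} {xs} → x ∉ xs → Unique xs → Unique (x ∷ xs)
  unique-∷ {xs = xs} x∉xs uxs = ¬Any⇒All¬ xs x∉xs ∷ uxs

  ∉-++⁺ : ∀ {x : A} {xs ys} → x ∉ xs → x ∉ ys → x ∉ xs ++ ys
  ∉-++⁺ {xs = xs} x∉xs x∉ys x∈ = [ x∉xs , x∉ys ] (∈-++⁻ xs x∈)

  pairwise-outside-one : ∀ {R : A → A → Set} {L : List A} {p} → (∀ {x} → x ∉ L → x ≡ p) →
                         ∀ {x y} → x ∉ L → y ∉ L → x ≢ y → R x y
  pairwise-outside-one only x∉ y∉ x≢y = ⊥-elim (x≢y (trans (only x∉) (sym (only y∉))))

  pairwise-outside-two : ∀ {R : A → A → Set} {L : List A} {p q} → (∀ {x y} → R x y → R y x) →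
                         (∀ {x} → x ∉ L → x ≡ p ⊎ x ≡ q) → R p q →
                         ∀ {x y} → x ∉ L → y ∉ L → x ≢ y → R x y
  pairwise-outside-two R-sym only Rpq x∉ y∉ x≢y with only x∉ | only y∉
  ... | inj₁ refl | inj₁ refl = ⊥-elim (x≢y refl)
  ... | inj₁ refl | inj₂ refl = Rpq
  ... | inj₂ refl | inj₁ refl = R-sym Rpq
  ... | inj₂ refl | inj₂ refl = ⊥-elim (x≢y refl)

  lookup-injective : ∀ {xs : List A} → Unique xs → ∀ {i j} → lookup xs i ≡ lookup xs j → i ≡ j
  lookup-injective (_ ∷ _)    {zero}  {zero}  _ = refl
  lookup-injective (x∉ ∷ _)   {zero}  {suc j} e = ⊥-elim (All.lookup x∉ (∈-lookup j) e)
  lookup-injective (x∉ ∷ _)   {suc i} {zero}  e = ⊥-elim (All.lookup x∉ (∈-lookup i) (sym e))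
  lookup-injective (_ ∷ uxs)  {suc i} {suc j} e = cong suc (lookup-injective uxs e)

  pairs : List A → List (A × A)
  pairs (x ∷ y ∷ xs) = (x , y) ∷ pairs xs
  pairs _            = []

  ∈-pairs⁻ : ∀ {x y} xs → (x , y) ∈ pairs xs → x ∈ xs × y ∈ xs
  ∈-pairs⁻ (_ ∷ _ ∷ _)  (here refl) = here refl , there (here refl)
  ∈-pairs⁻ (_ ∷ _ ∷ xs) (there p)   =
    let x∈ , y∈ = ∈-pairs⁻ xs p in there (there x∈) , there (there y∈)

  pairs-++ : ∀ xs {ys} → parity (length xs) ≡ 0ℙ → pairs (xs ++ ys) ≡ pairs xs ++ pairs ys
  pairs-++ []           _ = refl
  pairs-++ (x ∷ y ∷ xs) e = cong ((x , y) ∷_) (pairs-++ xs e)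

allPairs-lookup : ∀ {A : Set} {R : A → A → Set} {xs x y} → AllPairs R xs → x ∈ xs → y ∈ xs →
                  x ≡ y ⊎ R x y ⊎ R y x
allPairs-lookup (_ ∷ _)     (here refl) (here refl) = inj₁ refl
allPairs-lookup (Rx ∷ _)    (here refl) (there y∈)  = inj₂ (inj₁ (All.lookup Rx y∈))
allPairs-lookup (Rx ∷ _)    (there x∈)  (here refl) = inj₂ (inj₂ (All.lookup Rx x∈))
allPairs-lookup (_ ∷ Rxs)   (there x∈)  (there y∈)  = allPairs-lookup Rxs x∈ y∈

_⇔-dec_ : ∀ {A B : Set} → Dec A → Dec B → Dec (A ⇔ B)
a? ⇔-dec b? = Dec.map′ (λ (to , from) → mk⇔ to from) (λ e → Equivalence.to e , Equivalence.from e)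
  ((a? →-dec b?) ×-dec (b? →-dec a?))

odd-suc⇒even : ∀ {k} → parity (suc k) ≡ 1ℙ → parity k ≡ 0ℙ
odd-suc⇒even {k} k+1-odd = trans (sym (suc-homo-⁻¹ k)) (cong _⁻¹ k+1-odd)

2∣⇒even : ∀ {k} → 2 ∣ k → parity k ≡ 0ℙ
2∣⇒even (divides q refl) = trans (*-homo-* q 2) (*-zeroʳ (parity q))

odd⇒¬2∣ : ∀ {k} → parity k ≡ 1ℙ → ¬ 2 ∣ k
odd⇒¬2∣ k-odd 2∣k with trans (sym (2∣⇒even 2∣k)) k-odd
... | ()

another-element : ∀ {k} → parity k ≡ 0ℙ → (c : Fin k) → ∃[ a ] a ≢ c
another-element {suc (suc _)} _ zero    = suc zero , λ ()
another-element {suc (suc _)} _ (suc _) = zero , λ ()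
another-element {1}           () _

length-enumeration : ∀ {k} {xs : List (Fin k)} → Unique xs → (∀ i → i ∈ xs) → length xs ≡ k
length-enumeration {k} uxs ∈xs = trans
  (↭-length (∼bag⇒↭ (unique∧set⇒bag uxs (Unique.allFin⁺ k)
                                      (mk⇔ (λ _ → ∈-allFin _) (λ _ → ∈xs _)))))
  (length-tabulate _)

module _ {k : ℕ} where
  open import Data.List.Membership.DecPropositional (_≟_ {k}) using (_∈?_)

  allFinExcept : List (Fin k) → List (Fin k)
  allFinExcept S = filter (λ i → ¬? (i ∈? S)) (allFin k)

  ∈-allFinExcept⁺ : ∀ {S i} → i ∉ S → i ∈ allFinExcept S
  ∈-allFinExcept⁺ i∉S = ∈-filter⁺ _ (∈-allFin _) i∉S

  ∈-allFinExcept⁻ : ∀ {S i} → i ∈ allFinExcept S → i ∉ S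
  ∈-allFinExcept⁻ {S} p = proj₂ (∈-filter⁻ (λ i → ¬? (i ∈? S)) {xs = allFin k} p)

  ∉-allFinExcept : ∀ {S i} → i ∉ allFinExcept S → i ∈ S
  ∉-allFinExcept {S} {i} i∉ with i ∈? S
  ... | yes i∈S = i∈S
  ... | no i∉S  = ⊥-elim (i∉ (∈-allFinExcept⁺ i∉S))

  allFinExcept-unique : ∀ S → Unique (allFinExcept S)
  allFinExcept-unique S = Unique.filter⁺ _ (Unique.allFin⁺ k)

  length-allFinExcept : ∀ {S} → Unique S → length S + length (allFinExcept S) ≡ k
  length-allFinExcept {S} uS = trans (sym (length-++ S))
    (length-enumeration (Unique.++⁺ uS (allFinExcept-unique S) (λ (i∈S , i∈) → ∈-allFinExcept⁻ i∈ i∈S))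
                        complete)
    where
    complete : ∀ i → i ∈ S ++ allFinExcept S
    complete i with i ∈? S
    ... | yes i∈S = ∈-++⁺ˡ i∈S
    ... | no i∉S  = ∈-++⁺ʳ S (∈-allFinExcept⁺ i∉S)

module _ (G : Graph) where
  open Graph G

  dominating⇒maximal : ∀ {I} → Independent G I → (∀ v → v ∉ I → ∃[ u ] (u ∈ I × E v u)) →
                       MaximalIndependent G I
  dominating⇒maximal indI dom = indI , λ v v∉I ind →
    let u , u∈I , vu = dom v v∉I in proj₂ ind (here refl) (there u∈I) vu

  independent-∷-⊆ : ∀ {t I J} → Independent G I → I ⊆ J → Independent G (t ∷ J) →
                    Independent G (t ∷ I)
  independent-∷-⊆ {t} {I} {J} (uI , _) I⊆J ((t∉J ∷ _) , indJ) =
    (All.tabulate (λ x∈I → All.lookup t∉J (I⊆J x∈I)) ∷ uI) ,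
    λ u∈ v∈ → indJ (∷-⊆ u∈) (∷-⊆ v∈)
    where
    ∷-⊆ : ∀ {x} → x ∈ t ∷ I → x ∈ t ∷ J
    ∷-⊆ (here e)  = here e
    ∷-⊆ (there p) = there (I⊆J p)

  module FiniteGraph (vertices : List V) (∈-vertices : ∀ v → v ∈ vertices)
                     (_≟ᵥ_ : (u v : V) → Dec (u ≡ v)) (E? : ∀ u v → Dec (E u v)) where
    open import Data.List.Relation.Unary.Unique.DecPropositional _≟ᵥ_ using (unique?)

    independent? : ∀ I → Dec (Independent G I)
    independent? I = unique? I ×-dec Dec.map′
      (λ all u∈ v∈ → All.lookup (All.lookup all u∈) v∈)
      (λ ind → All.tabulate λ u∈ → All.tabulate λ v∈ → ind u∈ v∈)
      (All.all? (λ u → All.all? (λ v → ¬? (E? u v)) I) I)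

    record Extension (I ts : List V) : Set where
      field
        J           : List V
        independent : Independent G J
        ⊇I          : I ⊆ J
        length-≤    : length I ≤ length J
        saturated   : ∀ {t} → t ∈ ts → t ∈ J ⊎ ¬ Independent G (t ∷ J)

    extend : ∀ ts {I} → Independent G I → Extension I ts
    extend [] {I} indI = record
      { J = I ; independent = indI ; ⊇I = λ p → p ; length-≤ = ≤-refl ; saturated = λ () }
    extend (t ∷ ts) {I} indI with independent? (t ∷ I)
    ... | yes indtI = record
      { J = J ; independent = independent ; ⊇I = ⊇I ∘ there
      ; length-≤ = ≤-trans (n≤1+n _) length-≤
      ; saturated = λ { (here refl) → inj₁ (⊇I (here refl)) ; (there p) → saturated p } }
      where open Extension (extend ts indtI)
    ... | no ¬indtI = record
      { J = J ; independent = independent ; ⊇I = ⊇I ; length-≤ = length-≤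
      ; saturated = λ { (here refl) → inj₂ (¬indtI ∘ independent-∷-⊆ indI ⊇I)
                      ; (there p)   → saturated p } }
      where open Extension (extend ts indI)

    extend-to-maximal : ∀ {I} → Independent G I → ∃[ J ] (MaximalIndependent G J × length I ≤ length J)
    extend-to-maximal indI = J , (independent , maximal) , length-≤
      where
      open Extension (extend vertices indI)
      maximal : ∀ v → v ∉ J → ¬ Independent G (v ∷ J)
      maximal v v∉J with saturated (∈-vertices v)
      ... | inj₁ v∈J  = ⊥-elim (v∉J v∈J)
      ... | inj₂ ¬ind = ¬ind

    ¬wellCovered : ∀ {I J} → MaximalIndependent G I → Independent G J → length I < length J →
                   ¬ WellCovered G
    ¬wellCovered {I} maxI indJ |I|<|J| wc =
      let J′ , maxJ′ , |J|≤|J′| = extend-to-maximal indJ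
      in <-irrefl (wc I J′ maxI maxJ′) (≤-trans |I|<|J| |J|≤|J′|)

module TwoTokens (G : Graph) (_≺_ : Graph.V G → Graph.V G → Set)
                 (≺-isStrictTotalOrder : IsStrictTotalOrder _≡_ _≺_) (≺-irrelevant : Irrelevant _≺_) where
  open Graph G
  open IsStrictTotalOrder ≺-isStrictTotalOrder using (compare; irrefl; asym) renaming (_≟_ to _≟ᵥ_)

  Tok : Set
  Tok = Token G _≺_

  infix 4 _∈ₛ_
  _∈ₛ_ : V → Tok → Set
  _∈ₛ_ = _∈ₜ_ G _≺_

  Adjacent : Tok → Tok → Set
  Adjacent = TokenAdj G _≺_

  -- A record, not a product, so that Spans s u v determines s, u and v during unification.
  record Spans (s : Tok) (u v : V) : Set where
    constructor spans
    field
      first  : u ∈ₛ s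
      second : v ∈ₛ s
      only   : ∀ x → x ∈ₛ s → x ≡ u ⊎ x ≡ v

  spans-self : ∀ (s : Tok) → Spans s (proj₁ (proj₁ s)) (proj₂ (proj₁ s))
  spans-self _ = spans (inj₁ refl) (inj₂ refl) λ _ x∈s → x∈s

  spans-sym : ∀ {s u v} → Spans s u v → Spans s v u
  spans-sym (spans u∈s v∈s only) = spans v∈s u∈s λ x x∈s → swap (only x x∈s)

  spans-≢ : ∀ {s u v} → Spans s u v → u ≢ v
  spans-≢ {_ , a≺b} (spans _ _ only) refl =
    irrefl (trans (reduce (only _ (inj₁ refl))) (sym (reduce (only _ (inj₂ refl))))) a≺b

  ∉-spans : ∀ {s u v x} → Spans s u v → x ≢ u → x ≢ v → ¬ x ∈ₛ s
  ∉-spans (spans _ _ only) x≢u x≢v x∈s = [ x≢u , x≢v ] (only _ x∈s)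

  members-⊆⇒≡ : ∀ s t → (∀ x → x ∈ₛ s → x ∈ₛ t) → s ≡ t
  members-⊆⇒≡ ((a , b) , a≺b) ((c , d) , c≺d) s⊆t with s⊆t a (inj₁ refl) | s⊆t b (inj₂ refl)
  ... | inj₁ refl | inj₁ refl = ⊥-elim (irrefl refl a≺b)
  ... | inj₁ refl | inj₂ refl = cong ((a , b) ,_) (≺-irrelevant a≺b c≺d)
  ... | inj₂ refl | inj₁ refl = ⊥-elim (asym a≺b c≺d)
  ... | inj₂ refl | inj₂ refl = ⊥-elim (irrefl refl a≺b)

  spans-unique : ∀ {s t u v} → Spans s u v → Spans t u v → s ≡ t
  spans-unique {s} {t} (spans _ _ only) (spans u∈t v∈t _) =
    members-⊆⇒≡ s t λ x x∈s → [ (λ { refl → u∈t }) , (λ { refl → v∈t }) ] (only x x∈s)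

  token : ∀ u v → u ≢ v → Tok
  token u v u≢v with compare u v
  ... | tri< u≺v _ _ = (u , v) , u≺v
  ... | tri≈ _ u≡v _ = ⊥-elim (u≢v u≡v)
  ... | tri> _ _ v≺u = (v , u) , v≺u

  spans-token : ∀ u v (u≢v : u ≢ v) → Spans (token u v u≢v) u v
  spans-token u v u≢v with compare u v
  ... | tri< u≺v _ _ = spans-self ((u , v) , u≺v)
  ... | tri≈ _ u≡v _ = ⊥-elim (u≢v u≡v)
  ... | tri> _ _ v≺u = spans-sym (spans-self ((v , u) , v≺u))

  adjacent-sym : ∀ {s t} → Adjacent s t → Adjacent t s
  adjacent-sym (u , w , uw , sd) =
    u , w , uw , λ v → mk⇔ (Equivalence.to (sd v) ∘ swap) (swap ∘ Equivalence.from (sd v))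

  adjacent-irrefl : ∀ {s} → ¬ Adjacent s s
  adjacent-irrefl (u , _ , _ , sd) =
    [ (λ (u∈ , u∉) → u∉ u∈) , (λ (u∈ , u∉) → u∉ u∈) ] (Equivalence.from (sd u) (inj₁ refl))

  adjacent-of-shared : ∀ {s t p q r} → Spans s p q → Spans t p r → q ≢ r → E q r → Adjacent s t
  adjacent-of-shared {s} {t} {p} {q} {r} Hs@(spans p∈s q∈s only-s) Ht@(spans p∈t r∈t only-t) q≢r qr =
    q , r , qr , λ v → mk⇔ (to v) (from v)
    where
    to : ∀ v → InSymDiff G _≺_ v s t → v ≡ q ⊎ v ≡ r
    to v (inj₁ (v∈s , v∉t)) = [ (λ { refl → ⊥-elim (v∉t p∈t) }) , inj₁ ] (only-s v v∈s)
    to v (inj₂ (v∈t , v∉s)) = [ (λ { refl → ⊥-elim (v∉s p∈s) }) , inj₂ ] (only-t v v∈t)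
    from : ∀ v → v ≡ q ⊎ v ≡ r → InSymDiff G _≺_ v s t
    from _ (inj₁ refl) = inj₁ (q∈s , ∉-spans Ht (spans-≢ Hs ∘ sym) q≢r)
    from _ (inj₂ refl) = inj₂ (r∈t , ∉-spans Hs (spans-≢ Ht ∘ sym) (q≢r ∘ sym))

  Apart : Tok → Tok → Set
  Apart s t = s ≢ t × ¬ Adjacent s t

  -- The symmetric difference of adjacent tokens is an edge, so it has only two elements.
  apart-of-disjoint : ∀ {s t a b c d} → Spans s a b → Spans t c d →
                      a ≢ c → a ≢ d → b ≢ c → b ≢ d → Apart s t
  apart-of-disjoint {s} {t} {a} {b} {c} Hs@(spans a∈s b∈s _) Ht@(spans c∈t _ _) a≢c a≢d b≢c b≢d =
    (λ { refl → a∉t a∈s }) , λ (u , w , _ , sd) →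
      two-values (Equivalence.to (sd a) (inj₁ (a∈s , a∉t))) (Equivalence.to (sd b) (inj₁ (b∈s , b∉t)))
                 (Equivalence.to (sd c) (inj₂ (c∈t , c∉s)))
    where
    a∉t = ∉-spans Ht a≢c a≢d
    b∉t = ∉-spans Ht b≢c b≢d
    c∉s = ∉-spans Hs (a≢c ∘ sym) (b≢c ∘ sym)
    two-values : ∀ {u w} → a ≡ u ⊎ a ≡ w → b ≡ u ⊎ b ≡ w → c ≡ u ⊎ c ≡ w → ⊥
    two-values (inj₁ refl) (inj₁ refl) _           = spans-≢ Hs refl
    two-values (inj₂ refl) (inj₂ refl) _           = spans-≢ Hs refl
    two-values (inj₁ refl) _           (inj₁ refl) = a≢c refl
    two-values (inj₂ refl) _           (inj₂ refl) = a≢c refl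
    two-values _           (inj₁ refl) (inj₁ refl) = b≢c refl
    two-values _           (inj₂ refl) (inj₂ refl) = b≢c refl

  apart-of-shared : ∀ {s t p q r} → Spans s p q → Spans t p r → q ≢ r → ¬ E q r → ¬ E r q →
                    Apart s t
  apart-of-shared {s} {t} {p} {q} {r} Hs@(spans _ q∈s _) Ht@(spans _ r∈t _) q≢r ¬qr ¬rq =
    (λ { refl → q∉t q∈s }) , λ (u , w , uw , sd) →
      endpoints uw (Equivalence.to (sd q) (inj₁ (q∈s , q∉t))) (Equivalence.to (sd r) (inj₂ (r∈t , r∉s)))
    where
    q∉t = ∉-spans Ht (spans-≢ Hs ∘ sym) q≢r
    r∉s = ∉-spans Hs (spans-≢ Ht ∘ sym) (q≢r ∘ sym)
    endpoints : ∀ {u w} → E u w → q ≡ u ⊎ q ≡ w → r ≡ u ⊎ r ≡ w → ⊥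
    endpoints _  (inj₁ refl) (inj₁ refl) = q≢r refl
    endpoints uw (inj₁ refl) (inj₂ refl) = ¬qr uw
    endpoints uw (inj₂ refl) (inj₁ refl) = ¬rq uw
    endpoints _  (inj₂ refl) (inj₂ refl) = q≢r refl

  independent-of-apart : ∀ {I} → AllPairs Apart I → Independent (T₂ G _≺_) I
  independent-of-apart apart =
    AllPairs.map proj₁ apart , λ s∈ t∈ → nonadjacent (allPairs-lookup apart s∈ t∈)
    where
    nonadjacent : ∀ {s t} → s ≡ t ⊎ Apart s t ⊎ Apart t s → ¬ Adjacent s t
    nonadjacent {s} (inj₁ refl)        = adjacent-irrefl {s}
    nonadjacent     (inj₂ (inj₁ s∥t))  = proj₂ s∥t
    nonadjacent {s} {t} (inj₂ (inj₂ t∥s)) = proj₂ t∥s ∘ adjacent-sym {s} {t}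

  dominated-by-shared : ∀ {I s t p q r} → s ∉ I → t ∈ I → Spans s p q → Spans t p r →
                        (q ≢ r → E q r) → ∃[ t ] (t ∈ I × Adjacent s t)
  dominated-by-shared {I} {q = q} {r} s∉I t∈I Hs Ht qr with q ≟ᵥ r
  ... | yes refl = ⊥-elim (s∉I (subst (_∈ I) (sym (spans-unique Hs Ht)) t∈I))
  ... | no q≢r   = _ , t∈I , adjacent-of-shared Hs Ht q≢r (qr q≢r)

  module _ {A : Set} (ι : A → V) (ι-injective : ∀ {x y} → ι x ≡ ι y → x ≡ y) where

    pairTokens : (xs : List A) → Unique xs → List Tok
    pairTokens (x ∷ y ∷ xs) ((x≢y ∷ _) ∷ _ ∷ uxs) =
      token (ι x) (ι y) (x≢y ∘ ι-injective) ∷ pairTokens xs uxs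
    pairTokens _            _                     = []

    length-pairTokens : ∀ xs (uxs : Unique xs) → length (pairTokens xs uxs) ≡ ⌊ length xs /2⌋
    length-pairTokens []           _                 = refl
    length-pairTokens (_ ∷ [])     _                 = refl
    length-pairTokens (_ ∷ _ ∷ xs) ((_ ∷ _) ∷ _ ∷ uxs) = cong ℕ.suc (length-pairTokens xs uxs)

    ∈-pairTokens⁻ : ∀ xs (uxs : Unique xs) {s} → s ∈ pairTokens xs uxs →
                    ∃[ x ] ∃[ y ] ((x , y) ∈ pairs xs × Spans s (ι x) (ι y))
    ∈-pairTokens⁻ (x ∷ y ∷ _)  ((_ ∷ _) ∷ _ ∷ _)   (here refl) = x , y , here refl , spans-token _ _ _
    ∈-pairTokens⁻ (_ ∷ _ ∷ xs) ((_ ∷ _) ∷ _ ∷ uxs) (there s∈)  =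
      let x , y , xy∈ , Hs = ∈-pairTokens⁻ xs uxs s∈ in x , y , there xy∈ , Hs

    pairTokens-apart : ∀ xs (uxs : Unique xs) → AllPairs Apart (pairTokens xs uxs)
    pairTokens-apart []           _                              = []
    pairTokens-apart (_ ∷ [])     _                              = []
    pairTokens-apart (x ∷ y ∷ xs) ((x≢y ∷ x∉xs) ∷ y∉xs ∷ uxs) =
      All.tabulate head-apart ∷ pairTokens-apart xs uxs
      where
      ι≢ : ∀ {a b} → a ≢ b → ι a ≢ ι b
      ι≢ a≢b = a≢b ∘ ι-injective
      head-apart : ∀ {t} → t ∈ pairTokens xs uxs → Apart (token (ι x) (ι y) (x≢y ∘ ι-injective)) t
      head-apart t∈ =
        let a , b , ab∈ , Ht = ∈-pairTokens⁻ xs uxs t∈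
            a∈ , b∈ = ∈-pairs⁻ xs ab∈
        in apart-of-disjoint (spans-token _ _ _) Ht
             (ι≢ (All.lookup x∉xs a∈)) (ι≢ (All.lookup x∉xs b∈))
             (ι≢ (All.lookup y∉xs a∈)) (ι≢ (All.lookup y∉xs b∈))

    pairTokens-cover : ∀ xs (uxs : Unique xs) → parity (length xs) ≡ 0ℙ → ∀ {x} → x ∈ xs →
                       ∃[ y ] ∃[ s ] (s ∈ pairTokens xs uxs × Spans s (ι x) (ι y))
    pairTokens-cover (_ ∷ y ∷ _)  ((_ ∷ _) ∷ _ ∷ _)   _ (here refl)         =
      y , _ , here refl , spans-token _ _ _
    pairTokens-cover (x ∷ _ ∷ _)  ((_ ∷ _) ∷ _ ∷ _)   _ (there (here refl)) =
      x , _ , here refl , spans-sym (spans-token _ _ _)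
    pairTokens-cover (_ ∷ _ ∷ xs) ((_ ∷ _) ∷ _ ∷ uxs) e (there (there x∈))  =
      let y , s , s∈ , Hs = pairTokens-cover xs uxs e x∈ in y , s , there s∈ , Hs

  module Enumeration (vertices : List V) (∈-vertices : ∀ v → v ∈ vertices)
                     (E? : ∀ u v → Dec (E u v)) where
    open IsStrictTotalOrder ≺-isStrictTotalOrder using (_<?_)

    ∃? : ∀ {P : V → Set} → (∀ v → Dec (P v)) → Dec (∃[ v ] P v)
    ∃? P? = Dec.map′ satisfied (λ (v , p) → lose (∈-vertices v) p) (Any.any? P? vertices)

    ∀? : ∀ {P : V → Set} → (∀ v → Dec (P v)) → Dec (∀ v → P v)
    ∀? P? = Dec.map′ (λ all v → All.lookup all (∈-vertices v)) (λ h → All.tabulate λ {v} _ → h v)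
                     (All.all? P? vertices)

    _∈ₛ?_ : ∀ v s → Dec (v ∈ₛ s)
    v ∈ₛ? ((a , b) , _) = (v ≟ᵥ a) ⊎-dec (v ≟ᵥ b)

    adjacent? : ∀ s t → Dec (Adjacent s t)
    adjacent? s t =
      ∃? λ u → ∃? λ w → E? u w ×-dec ∀? λ v → symDiff? v ⇔-dec ((v ≟ᵥ u) ⊎-dec (v ≟ᵥ w))
      where
      symDiff? : ∀ v → Dec (InSymDiff G _≺_ v s t)
      symDiff? v = (v ∈ₛ? s ×-dec ¬? (v ∈ₛ? t)) ⊎-dec (v ∈ₛ? t ×-dec ¬? (v ∈ₛ? s))

    _≟ₜ_ : (s t : Tok) → Dec (s ≡ t)
    ((a , b) , a≺b) ≟ₜ ((c , d) , c≺d) with a ≟ᵥ c | b ≟ᵥ d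
    ... | yes refl | yes refl = yes (cong ((a , b) ,_) (≺-irrelevant a≺b c≺d))
    ... | no a≢c   | _        = no (a≢c ∘ cong (proj₁ ∘ proj₁))
    ... | yes _    | no b≢d   = no (b≢d ∘ cong (proj₂ ∘ proj₁))

    ordered : V → V → List Tok
    ordered u v with u <? v
    ... | yes u≺v = ((u , v) , u≺v) ∷ []
    ... | no _    = []

    ∈-ordered : ∀ {u v} (u≺v : u ≺ v) → ((u , v) , u≺v) ∈ ordered u v
    ∈-ordered {u} {v} u≺v with u <? v
    ... | yes u≺v′ = here (cong ((u , v) ,_) (≺-irrelevant u≺v u≺v′))
    ... | no ¬u≺v  = ⊥-elim (¬u≺v u≺v)

    tokens : List Tok
    tokens = concatMap (λ u → concatMap (ordered u) vertices) vertices

    ∈-tokens : ∀ s → s ∈ tokens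
    ∈-tokens ((u , v) , u≺v) =
      ∈-concatMap⁺ _ (lose (∈-vertices u)
        (∈-concatMap⁺ (ordered u) (lose (∈-vertices v) (∈-ordered u≺v))))

    open FiniteGraph (T₂ G _≺_) tokens ∈-tokens _≟ₜ_ adjacent? public using (¬wellCovered)

module _ {m n : ℕ} where

  ≺-trans : Transitive (_≺_ {m} {n})
  ≺-trans {inj₁ _} {inj₁ _} {inj₁ _} a<b b<c = FinP.<-trans a<b b<c
  ≺-trans {inj₁ _} {inj₁ _} {inj₂ _} _   _   = tt
  ≺-trans {inj₁ _} {inj₂ _} {inj₂ _} _   _   = tt
  ≺-trans {inj₂ _} {inj₂ _} {inj₂ _} a<b b<c = FinP.<-trans a<b b<c
  ≺-trans {inj₁ _} {inj₂ _} {inj₁ _} _   ()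
  ≺-trans {inj₂ _} {inj₁ _}          ()  _
  ≺-trans {inj₂ _} {inj₂ _} {inj₁ _} _   ()

  ≺-irrefl : Irreflexive _≡_ (_≺_ {m} {n})
  ≺-irrefl {inj₁ _} refl = FinP.<-irrefl refl
  ≺-irrefl {inj₂ _} refl = FinP.<-irrefl refl

  ≺-compare : Trichotomous _≡_ (_≺_ {m} {n})
  ≺-compare (inj₁ a) (inj₁ b) with FinP.<-cmp a b
  ... | tri< a<b a≢b b≮a = tri< a<b (a≢b ∘ inj₁-injective) b≮a
  ... | tri≈ a≮b refl b≮a = tri≈ a≮b refl b≮a
  ... | tri> a≮b a≢b b<a = tri> a≮b (a≢b ∘ inj₁-injective) b<a
  ≺-compare (inj₁ _) (inj₂ _) = tri< tt (λ ()) (λ ())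
  ≺-compare (inj₂ _) (inj₁ _) = tri> (λ ()) (λ ()) tt
  ≺-compare (inj₂ a) (inj₂ b) with FinP.<-cmp a b
  ... | tri< a<b a≢b b≮a = tri< a<b (a≢b ∘ inj₂-injective) b≮a
  ... | tri≈ a≮b refl b≮a = tri≈ a≮b refl b≮a
  ... | tri> a≮b a≢b b<a = tri> a≮b (a≢b ∘ inj₂-injective) b<a

  ≺-isStrictTotalOrder : IsStrictTotalOrder _≡_ (_≺_ {m} {n})
  ≺-isStrictTotalOrder = record
    { isStrictPartialOrder = record
      { isEquivalence = isEquivalence ; irrefl = ≺-irrefl ; trans = ≺-trans ; <-resp-≈ = resp₂ _≺_ }
    ; compare = ≺-compare }

  ≺-irrelevant : Irrelevant (_≺_ {m} {n})
  ≺-irrelevant {inj₁ _} {inj₁ _} = FinP.<-irrelevant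
  ≺-irrelevant {inj₁ _} {inj₂ _} = λ _ _ → refl
  ≺-irrelevant {inj₂ _} {inj₂ _} = FinP.<-irrelevant
  ≺-irrelevant {inj₂ _} {inj₁ _} = λ ()

  vertices : List (VG m n)
  vertices = map inj₁ (allFin m) ++ map inj₂ (allFin n)

  ∈-vertices : ∀ v → v ∈ vertices
  ∈-vertices (inj₁ a) = ∈-++⁺ˡ (∈-map⁺ inj₁ (∈-allFin a))
  ∈-vertices (inj₂ b) = ∈-++⁺ʳ (map inj₁ (allFin m)) (∈-map⁺ inj₂ (∈-allFin b))

  EG? : (B : Fin m → Fin n → Bool) → ∀ u v → Dec (EG B u v)
  EG? B (inj₁ a) (inj₁ a′) = ¬? (a FinP.≟ a′)
  EG? B (inj₁ a) (inj₂ b)  = B a b Bool.≟ true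
  EG? B (inj₂ b) (inj₁ a)  = B a b Bool.≟ true
  EG? B (inj₂ b) (inj₂ b′) = ¬? (b FinP.≟ b′)

Free : ∀ {m n} → (Fin m → Fin n → Bool) → Fin n → Set
Free B u = ∀ i → B i u ≢ true

module TokenGraphOf𝒢 {m n : ℕ} (B : Fin m → Fin n → Bool) where
  open TwoTokens (graphG m n B) _≺_ ≺-isStrictTotalOrder ≺-irrelevant public
  open Enumeration vertices ∈-vertices (EG? B) public using (¬wellCovered)
  open import Data.List.Membership.DecPropositional (FinP._≟_ {m}) using () renaming (_∈?_ to _∈X?_)
  open import Data.List.Membership.DecPropositional (FinP._≟_ {n}) using () renaming (_∈?_ to _∈Y?_)

  𝒯 : Graph
  𝒯 = T₂ (graphG m n B) _≺_

  matchToken : Fin m → Fin n → Tok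
  matchToken i u = (inj₁ i , inj₂ u) , tt

  -- If f i = u, the tokens {x_i, y_u} and {y_u, y_v} are adjacent exactly when x_i y_v is an edge.
  Compatible : (Fin m → Fin n) → Fin n × Fin n → Set
  Compatible f (u , v) = (∀ i → f i ≡ u → B i v ≢ true) × (∀ i → f i ≡ v → B i u ≢ true)

  DominatesX : (Fin m → Fin n) → Fin m → Fin m → Set
  DominatesX f c d = B c (f d) ≡ true ⊎ B d (f c) ≡ true

  DominatesY : (Fin m → Fin n) → Fin n → Fin n → Set
  DominatesY f u v = ∃[ i ] ((f i ≡ u × B i v ≡ true) ⊎ (f i ≡ v × B i u ≡ true))

  DominatesY-sym : ∀ {f u v} → DominatesY f u v → DominatesY f v u
  DominatesY-sym (i , Bi) = i , swap Bi

  module Configuration (f : Fin m → Fin n) (LX : List (Fin m)) (LX-unique : Unique LX)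
                       (LY : List (Fin n)) (LY-unique : Unique LY) where

    matchings xPairs yPairs tokenSet : List Tok
    matchings = map (λ i → matchToken i (f i)) (allFin m)
    xPairs    = pairTokens inj₁ inj₁-injective LX LX-unique
    yPairs    = pairTokens inj₂ inj₂-injective LY LY-unique
    tokenSet  = matchings ++ xPairs ++ yPairs

    length-tokenSet : length tokenSet ≡ m + (⌊ length LX /2⌋ + ⌊ length LY /2⌋)
    length-tokenSet = begin
      length (matchings ++ xPairs ++ yPairs)        ≡⟨ length-++ matchings ⟩
      length matchings + length (xPairs ++ yPairs)  ≡⟨ cong₂ _+_ length-matchings (length-++ xPairs) ⟩
      m + (length xPairs + length yPairs)           ≡⟨ cong (m +_) (cong₂ _+_
                                                         (length-pairTokens inj₁ inj₁-injective LX LX-unique)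
                                                         (length-pairTokens inj₂ inj₂-injective LY LY-unique)) ⟩
      m + (⌊ length LX /2⌋ + ⌊ length LY /2⌋)       ∎
      where
      open ≡-Reasoning
      length-matchings : length matchings ≡ m
      length-matchings = trans (length-map _ (allFin m)) (length-tabulate _)

    independent : (∀ {i j} → f i ≡ f j → i ≡ j) → (∀ {c} → c ∈ LX → Free B (f c)) →
                  All (Compatible f) (pairs LY) → Independent 𝒯 tokenSet
    independent f-injective LX-free compatible = independent-of-apart
      (AllPairsP.++⁺ matchings-apart
        (AllPairsP.++⁺ (pairTokens-apart inj₁ inj₁-injective LX LX-unique)
                       (pairTokens-apart inj₂ inj₂-injective LY LY-unique)
                       (All.tabulate λ s∈ → All.tabulate λ t∈ → xPair-apart-yPair s∈ t∈))
        (AllP.map⁺ (All.tabulate λ {i} _ →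
          AllP.++⁺ (All.tabulate (matching-apart-xPair i)) (All.tabulate (matching-apart-yPair i)))))
      where
      matchings-apart : AllPairs Apart matchings
      matchings-apart = AllPairsP.map⁺ (AllPairs.map
        (λ i≢j → apart-of-disjoint (spans-self _) (spans-self _)
                   (i≢j ∘ inj₁-injective) (λ ()) (λ ()) (i≢j ∘ f-injective ∘ inj₂-injective))
        (Unique.allFin⁺ m))

      matching-apart-xPair : ∀ i {s} → s ∈ xPairs → Apart (matchToken i (f i)) s
      matching-apart-xPair i s∈ with ∈-pairTokens⁻ inj₁ inj₁-injective LX LX-unique s∈
      ... | c , d , cd∈ , Hs with ∈-pairs⁻ LX cd∈ | i FinP.≟ c | i FinP.≟ d
      ... | c∈ , _  | yes refl | _        =
        apart-of-shared (spans-self _) Hs (λ ()) (LX-free c∈ d) (LX-free c∈ d)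
      ... | _ , d∈  | no _     | yes refl =
        apart-of-shared (spans-self _) (spans-sym Hs) (λ ()) (LX-free d∈ c) (LX-free d∈ c)
      ... | _       | no i≢c   | no i≢d   =
        apart-of-disjoint (spans-self _) Hs (i≢c ∘ inj₁-injective) (i≢d ∘ inj₁-injective) (λ ()) (λ ())

      matching-apart-yPair : ∀ i {s} → s ∈ yPairs → Apart (matchToken i (f i)) s
      matching-apart-yPair i s∈ with ∈-pairTokens⁻ inj₂ inj₂-injective LY LY-unique s∈
      ... | u , v , uv∈ , Hs with All.lookup compatible uv∈ | f i FinP.≟ u | f i FinP.≟ v
      ... | ¬Bi[v] , _ | yes refl | _        =
        apart-of-shared (spans-sym (spans-self _)) Hs (λ ()) (¬Bi[v] i refl) (¬Bi[v] i refl)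
      ... | _ , ¬Bi[u] | no _     | yes refl =
        apart-of-shared (spans-sym (spans-self _)) (spans-sym Hs) (λ ()) (¬Bi[u] i refl) (¬Bi[u] i refl)
      ... | _          | no fi≢u  | no fi≢v  =
        apart-of-disjoint (spans-self _) Hs (λ ()) (λ ()) (fi≢u ∘ inj₂-injective) (fi≢v ∘ inj₂-injective)

      xPair-apart-yPair : ∀ {s t} → s ∈ xPairs → t ∈ yPairs → Apart s t
      xPair-apart-yPair s∈ t∈ =
        let _ , _ , _ , Hs = ∈-pairTokens⁻ inj₁ inj₁-injective LX LX-unique s∈
            _ , _ , _ , Ht = ∈-pairTokens⁻ inj₂ inj₂-injective LY LY-unique t∈
        in apart-of-disjoint Hs Ht (λ ()) (λ ()) (λ ()) (λ ())

    matching∈ : ∀ i → matchToken i (f i) ∈ tokenSet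
    matching∈ i = ∈-++⁺ˡ (∈-map⁺ _ (∈-allFin i))

    xPair∈ : ∀ {s} → s ∈ xPairs → s ∈ tokenSet
    xPair∈ = ∈-++⁺ʳ matchings ∘ ∈-++⁺ˡ

    yPair∈ : ∀ {s} → s ∈ yPairs → s ∈ tokenSet
    yPair∈ = ∈-++⁺ʳ matchings ∘ ∈-++⁺ʳ xPairs

    dominating : parity (length LX) ≡ 0ℙ → parity (length LY) ≡ 0ℙ →
                 (∀ {c d} → c ∉ LX → d ∉ LX → c ≢ d → DominatesX f c d) →
                 (∀ {u v} → u ∉ LY → v ∉ LY → u ≢ v → DominatesY f u v) →
                 ∀ s → s ∉ tokenSet → ∃[ t ] (t ∈ tokenSet × Adjacent s t)
    dominating _ _ _ _ s@((inj₁ c , inj₂ u) , _) s∉ =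
      dominated-by-shared s∉ (matching∈ c) (spans-self s) (spans-self _) (λ u≢fc → u≢fc ∘ cong inj₂)
    dominating _ _ _ _ ((inj₂ _ , inj₁ _) , ())
    dominating LX-even _ dominatesX _ s@((inj₁ c , inj₁ d) , _) s∉ with c ∈X? LX | d ∈X? LX
    ... | yes c∈ | _      =
      let _ , _ , t∈ , Ht = pairTokens-cover inj₁ inj₁-injective LX LX-unique LX-even c∈
      in dominated-by-shared s∉ (xPair∈ t∈) (spans-self s) Ht (λ d≢e → d≢e ∘ cong inj₁)
    ... | no _   | yes d∈ =
      let _ , _ , t∈ , Ht = pairTokens-cover inj₁ inj₁-injective LX LX-unique LX-even d∈
      in dominated-by-shared s∉ (xPair∈ t∈) (spans-sym (spans-self s)) Ht (λ c≢e → c≢e ∘ cong inj₁)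
    ... | no c∉  | no d∉  with dominatesX c∉ d∉ (spans-≢ (spans-self s) ∘ cong inj₁)
    ...   | inj₁ Bc[fd] =
      _ , matching∈ d , adjacent-of-shared (spans-sym (spans-self s)) (spans-self _) (λ ()) Bc[fd]
    ...   | inj₂ Bd[fc] =
      _ , matching∈ c , adjacent-of-shared (spans-self s) (spans-self _) (λ ()) Bd[fc]
    dominating _ LY-even _ dominatesY s@((inj₂ u , inj₂ v) , _) s∉ with u ∈Y? LY | v ∈Y? LY
    ... | yes u∈ | _      =
      let _ , _ , t∈ , Ht = pairTokens-cover inj₂ inj₂-injective LY LY-unique LY-even u∈
      in dominated-by-shared s∉ (yPair∈ t∈) (spans-self s) Ht (λ v≢e → v≢e ∘ cong inj₂)
    ... | no _   | yes v∈ =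
      let _ , _ , t∈ , Ht = pairTokens-cover inj₂ inj₂-injective LY LY-unique LY-even v∈
      in dominated-by-shared s∉ (yPair∈ t∈) (spans-sym (spans-self s)) Ht (λ u≢e → u≢e ∘ cong inj₂)
    ... | no u∉  | no v∉  with dominatesY u∉ v∉ (spans-≢ (spans-self s) ∘ cong inj₂)
    ...   | i , inj₁ (refl , Bi[v]) =
      _ , matching∈ i , adjacent-of-shared (spans-self s) (spans-sym (spans-self _)) (λ ()) Bi[v]
    ...   | i , inj₂ (refl , Bi[u]) =
      _ , matching∈ i , adjacent-of-shared (spans-sym (spans-self s)) (spans-sym (spans-self _)) (λ ()) Bi[u]

    maximal : Independent 𝒯 tokenSet → parity (length LX) ≡ 0ℙ → parity (length LY) ≡ 0ℙ →
              (∀ {c d} → c ∉ LX → d ∉ LX → c ≢ d → DominatesX f c d) →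
              (∀ {u v} → u ∉ LY → v ∉ LY → u ≢ v → DominatesY f u v) →
              MaximalIndependent 𝒯 tokenSet
    maximal indep LX-even LY-even dominatesX dominatesY =
      dominating⇒maximal 𝒯 indep (dominating LX-even LY-even dominatesX dominatesY)

module FreeVertices {m n : ℕ} (B : Fin m → Fin n → Bool) where

  hasNeighbour : Fin n → Bool
  hasNeighbour u = any (λ a → B a u) (allFin m)

  free? : ∀ u → Dec (¬ T (hasNeighbour u))
  free? u = ¬? (T? (hasNeighbour u))

  free : List (Fin n)
  free = filter free? (allFin n)

  free-unique : Unique free
  free-unique = Unique.filter⁺ _ (Unique.allFin⁺ n)

  ∈free⇒Free : ∀ {u} → u ∈ free → Free B u
  ∈free⇒Free u∈ i Biu =
    proj₂ (∈-filter⁻ free? {xs = allFin n} u∈) (any⁺ _ (lose (∈-allFin i) (subst T (sym Biu) tt)))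

  nbrCountY+length-free : nbrCountY B + length free ≡ n
  nbrCountY+length-free = trans (sym (length-++ (filterᵇ hasNeighbour (allFin n))))
    (length-enumeration (Unique.++⁺ (Unique.filter⁺ _ (Unique.allFin⁺ n)) free-unique
                          λ (u∈₁ , u∈₂) → proj₂ (∈-filter⁻ free? {xs = allFin n} u∈₂)
                                                (proj₂ (∈-filter⁻ (T? ∘ hasNeighbour) {xs = allFin n} u∈₁)))
                        complete)
    where
    complete : ∀ u → u ∈ filterᵇ hasNeighbour (allFin n) ++ free
    complete u with T? (hasNeighbour u)
    ... | yes t = ∈-++⁺ˡ (∈-filter⁺ _ (∈-allFin u) t)
    ... | no ¬t = ∈-++⁺ʳ _ (∈-filter⁺ _ (∈-allFin u) ¬t)

  m≤length-free : m ≤ n → nbrCountY B ≤ n ∸ m → m ≤ length free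
  m≤length-free m≤n few-neighbours = +-cancelˡ-≤ (nbrCountY B) m (length free) (begin
    nbrCountY B + m            ≤⟨ +-monoˡ-≤ m few-neighbours ⟩
    n ∸ m + m                  ≡⟨ m∸n+n≡m m≤n ⟩
    n                          ≡⟨ nbrCountY+length-free ⟨
    nbrCountY B + length free  ∎)
    where open ≤-Reasoning

  free-injection : m ≤ n → nbrCountY B ≤ n ∸ m →
                   ∃[ w ] ((∀ {i j} → w i ≡ w j → i ≡ j) × (∀ i → Free B (w i)))
  free-injection m≤n few-neighbours = (λ i → lookup free (inject≤ i m≤))
    , (λ {i} {j} e → toℕ-injective (trans (sym (toℕ-inject≤ i m≤))
                       (trans (cong toℕ (lookup-injective free-unique e)) (toℕ-inject≤ j m≤))))
    , λ i → ∈free⇒Free (∈-lookup _)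
    where
    m≤ : m ≤ length free
    m≤ = m≤length-free m≤n few-neighbours

crossing-edge : ∀ {m n} {B : Fin m → Fin n → Bool} {a b} →
                Walk (graphG m n B) (inj₁ a) (inj₂ b) → ∃[ c ] ∃[ z ] B c z ≡ true
crossing-edge (step {v = inj₁ _} _   walk) = crossing-edge walk
crossing-edge (step {v = inj₂ z} Baz _)    = _ , z , Baz

module Construction {m n : ℕ} (B : Fin m → Fin n → Bool) (c : Fin m) (z : Fin n) (Bcz : B c z ≡ true)
                    (w : Fin m → Fin n) (w-injective : ∀ {i j} → w i ≡ w j → i ≡ j)
                    (w-free : ∀ i → Free B (w i)) where
  open TokenGraphOf𝒢 B

  Outside : (Fin m → Fin n) → Fin n → Set
  Outside f u = ∀ i → f i ≢ u

  w≢z : ∀ i → w i ≢ z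
  w≢z i wi≡z = w-free i c (subst (λ u → B c u ≡ true) (sym wi≡z) Bcz)

  z∉images : ∀ {Xs} → z ∉ map w Xs
  z∉images z∈ = let i , _ , z≡wi = ∈-map⁻ w z∈ in w≢z i (sym z≡wi)

  ∉-images : ∀ {Xs i} → i ∉ Xs → w i ∉ map w Xs
  ∉-images i∉ wi∈ =
    let j , j∈ , wi≡wj = ∈-map⁻ w wi∈ in i∉ (subst (_∈ _) (sym (w-injective wi≡wj)) j∈)

  images-free : ∀ {Xs u} → u ∈ map w Xs → Free B u
  images-free u∈ = let i , _ , u≡wi = ∈-map⁻ w u∈ in subst (Free B) (sym u≡wi) (w-free i)

  images++-unique : ∀ {Xs S} → Unique Xs → Unique S → (∀ {i} → i ∈ Xs → w i ∉ S) →
                    Unique (map w Xs ++ S)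
  images++-unique uXs uS disjoint = Unique.++⁺ (Unique.map⁺ w-injective uXs) uS λ (u∈ , u∈S) →
    let i , i∈ , u≡wi = ∈-map⁻ w u∈ in disjoint i∈ (subst (_∈ _) u≡wi u∈S)

  R : List (Fin n)
  R = allFinExcept (z ∷ tabulate w)

  R-unique : Unique R
  R-unique = allFinExcept-unique _

  z∉R : z ∉ R
  z∉R z∈ = ∈-allFinExcept⁻ z∈ (here refl)

  w∉R : ∀ i → w i ∉ R
  w∉R i wi∈ = ∈-allFinExcept⁻ wi∈ (there (∈-tabulate⁺ i))

  length-R : suc (m + length R) ≡ n
  length-R = trans (cong (λ k → suc k + length R) (sym (length-tabulate w)))
    (length-allFinExcept (unique-∷ (λ z∈ → let i , z≡wi = ∈-tabulate⁻ z∈ in w≢z i (sym z≡wi))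
                                   (Unique.tabulate⁺ w-injective)))

  classify : ∀ u → (∃[ i ] w i ≡ u) ⊎ u ≡ z ⊎ u ∈ R
  classify u with u FinP.≟ z | FinP.any? (λ i → w i FinP.≟ u)
  ... | yes u≡z | _            = inj₂ (inj₁ u≡z)
  ... | no _    | yes wi≡u     = inj₁ wi≡u
  ... | no u≢z  | no ¬wi≡u     = inj₂ (inj₂ (∈-allFinExcept⁺ λ
    { (here u≡z) → u≢z u≡z
    ; (there u∈) → let i , u≡wi = ∈-tabulate⁻ u∈ in ¬wi≡u (i , sym u≡wi) }))

  pairs-compatible : ∀ f Xs S → parity (length Xs) ≡ 0ℙ → (∀ {u} → u ∈ S → Outside f u) →
                     All (Compatible f) (pairs (map w Xs ++ S))
  pairs-compatible f Xs S Xs-even S-outside =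
    subst (All (Compatible f)) (sym (pairs-++ (map w Xs) (trans (cong parity (length-map w Xs)) Xs-even)))
      (AllP.++⁺ (All.tabulate λ uv∈ → let u∈ , v∈ = ∈-pairs⁻ _ uv∈ in
                   (λ i _ → images-free v∈ i) , (λ i _ → images-free u∈ i))
                (All.tabulate λ uv∈ → let u∈ , v∈ = ∈-pairs⁻ _ uv∈ in
                   (λ i → ⊥-elim ∘ S-outside u∈ i) , (λ i → ⊥-elim ∘ S-outside v∈ i)))

  redirect : Fin m → Fin m → Fin n
  redirect a = updateAt w a (λ _ → z)

  redirect-at : ∀ a → redirect a a ≡ z
  redirect-at a = updateAt-updates a w

  redirect-else : ∀ {a i} → i ≢ a → redirect a i ≡ w i
  redirect-else {a} {i} i≢a = updateAt-minimal i a w i≢a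

  redirect-cases : ∀ a i → (i ≡ a × redirect a i ≡ z) ⊎ (i ≢ a × redirect a i ≡ w i)
  redirect-cases a i with i FinP.≟ a
  ... | yes refl = inj₁ (refl , redirect-at a)
  ... | no i≢a   = inj₂ (i≢a , redirect-else i≢a)

  redirect-injective : ∀ a {i j} → redirect a i ≡ redirect a j → i ≡ j
  redirect-injective a {i} {j} e with redirect-cases a i | redirect-cases a j
  ... | inj₁ (refl , _)  | inj₁ (refl , _)  = refl
  ... | inj₁ (_ , fi≡z)  | inj₂ (_ , fj≡wj) = ⊥-elim (w≢z j (trans (sym fj≡wj) (trans (sym e) fi≡z)))
  ... | inj₂ (_ , fi≡wi) | inj₁ (_ , fj≡z)  = ⊥-elim (w≢z i (trans (sym fi≡wi) (trans e fj≡z)))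
  ... | inj₂ (_ , fi≡wi) | inj₂ (_ , fj≡wj) = w-injective (trans (sym fi≡wi) (trans e fj≡wj))

  R-outside : ∀ {f} → (∀ i → f i ≡ z ⊎ f i ≡ w i) → ∀ {u} → u ∈ R → Outside f u
  R-outside f-values u∈R i fi≡u with f-values i
  ... | inj₁ fi≡z  = z∉R (subst (_∈ R) (trans (sym fi≡u) fi≡z) u∈R)
  ... | inj₂ fi≡wi = w∉R i (subst (_∈ R) (trans (sym fi≡u) fi≡wi) u∈R)

  redirect-values : ∀ a i → redirect a i ≡ z ⊎ redirect a i ≡ w i
  redirect-values a i = Sum.map proj₂ proj₂ (redirect-cases a i)

  redirect-outside-w : ∀ a → Outside (redirect a) (w a)
  redirect-outside-w a i fi≡wa with redirect-cases a i
  ... | inj₁ (_ , fi≡z)     = w≢z a (trans (sym fi≡wa) fi≡z)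
  ... | inj₂ (i≢a , fi≡wi)  = i≢a (w-injective (trans (sym fi≡wi) fi≡wa))

  redirect-compatible : ∀ a → Compatible (redirect a) (z , w a)
  redirect-compatible a = (λ i _ → w-free a i) , (λ i fi≡wa → ⊥-elim (redirect-outside-w a i fi≡wa))

  module OddCase (m-odd : parity m ≡ 1ℙ) (n-even : parity n ≡ 0ℙ) where
    Xc : List (Fin m)
    Xc = allFinExcept (c ∷ [])

    length-Xc : suc (length Xc) ≡ m
    length-Xc = length-allFinExcept (unique-∷ (λ ()) [])

    Xc-even : parity (length Xc) ≡ 0ℙ
    Xc-even = odd-suc⇒even {length Xc} (trans (cong parity length-Xc) m-odd)

    outside-Xc : ∀ {i} → i ∉ Xc → i ≡ c
    outside-Xc i∉ with ∉-allFinExcept i∉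
    ... | here i≡c = i≡c

    LY : List (Fin n)
    LY = map w Xc ++ R

    LY-unique : Unique LY
    LY-unique = images++-unique (allFinExcept-unique _) R-unique (λ {i} _ → w∉R i)

    length-LY : suc (suc (length LY)) ≡ n
    length-LY = begin
      suc (suc (length (map w Xc ++ R)))  ≡⟨ cong (λ k → suc (suc k)) (length-++ (map w Xc) {R}) ⟩
      suc (suc (length (map w Xc) + length R))  ≡⟨ cong (λ k → suc (suc k + length R)) (length-map w Xc) ⟩
      suc (suc (length Xc) + length R)  ≡⟨ cong (λ k → suc (k + length R)) length-Xc ⟩
      suc (m + length R)  ≡⟨ length-R ⟩
      n  ∎
      where open ≡-Reasoning

    outside-LY : ∀ {u} → u ∉ LY → u ≡ w c ⊎ u ≡ z
    outside-LY {u} u∉ with classify u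
    ... | inj₁ (i , refl)  = inj₁ (cong w (outside-Xc (u∉ ∘ ∈-++⁺ˡ ∘ ∈-map⁺ w)))
    ... | inj₂ (inj₁ u≡z)  = inj₂ u≡z
    ... | inj₂ (inj₂ u∈R)  = ⊥-elim (u∉ (∈-++⁺ʳ _ u∈R))

    module I = Configuration w Xc (allFinExcept-unique _) LY LY-unique

    zwcLY-unique : Unique (z ∷ w c ∷ LY)
    zwcLY-unique =
      unique-∷ (λ { (here z≡wc) → w≢z c (sym z≡wc) ; (there z∈) → ∉-++⁺ z∉images z∉R z∈ })
        (unique-∷ (∉-++⁺ (∉-images (λ c∈ → ∈-allFinExcept⁻ c∈ (here refl))) (w∉R c)) LY-unique)

    module J = Configuration (redirect c) Xc (allFinExcept-unique _) (z ∷ w c ∷ LY) zwcLY-unique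

    I-maximal : MaximalIndependent 𝒯 I.tokenSet
    I-maximal = I.maximal
      (I.independent w-injective (λ _ → w-free _)
        (pairs-compatible w Xc R Xc-even (R-outside (λ _ → inj₂ refl))))
      Xc-even (trans (cong parity length-LY) n-even)
      (pairwise-outside-one {R = DominatesX w} outside-Xc)
      (pairwise-outside-two {R = DominatesY w} DominatesY-sym outside-LY (c , inj₁ (refl , Bcz)))

    J-independent : Independent 𝒯 J.tokenSet
    J-independent = J.independent (redirect-injective c)
      (λ {i} i∈ → subst (Free B) (sym (redirect-else (λ i≡c → ∈-allFinExcept⁻ i∈ (here i≡c)))) (w-free i))
      (redirect-compatible c ∷ pairs-compatible (redirect c) Xc R Xc-even (R-outside (redirect-values c)))

    ¬wellCovered-odd : ¬ WellCovered 𝒯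
    ¬wellCovered-odd = ¬wellCovered I-maximal J-independent
      (subst₂ _<_ (sym I.length-tokenSet) (sym J.length-tokenSet) (+-monoʳ-< m (+-monoʳ-< _ (n<1+n _))))

  module EvenCase (m-even : parity m ≡ 0ℙ) (a : Fin m) (a≢c : a ≢ c) where
    Xac : List (Fin m)
    Xac = allFinExcept (a ∷ c ∷ [])

    Xac-unique : Unique Xac
    Xac-unique = allFinExcept-unique _

    length-Xac : suc (suc (length Xac)) ≡ m
    length-Xac =
      length-allFinExcept (unique-∷ (λ { (here a≡c) → a≢c a≡c ; (there ()) }) (unique-∷ (λ ()) []))

    Xac-even : parity (length Xac) ≡ 0ℙ
    Xac-even = trans (cong parity length-Xac) m-even

    outside-Xac : ∀ {i} → i ∉ Xac → i ≡ a ⊎ i ≡ c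
    outside-Xac i∉ with ∉-allFinExcept i∉
    ... | here i≡a         = inj₁ i≡a
    ... | there (here i≡c) = inj₂ i≡c

    a∉Xac : a ∉ Xac
    a∉Xac a∈ = ∈-allFinExcept⁻ a∈ (here refl)

    c∉Xac : c ∉ Xac
    c∉Xac c∈ = ∈-allFinExcept⁻ c∈ (there (here refl))

    LXJ : List (Fin m)
    LXJ = a ∷ c ∷ Xac

    LXJ-unique : Unique LXJ
    LXJ-unique =
      unique-∷ (λ { (here a≡c) → a≢c a≡c ; (there a∈) → a∉Xac a∈ }) (unique-∷ c∉Xac Xac-unique)

    -- When n is even LYJ has odd length and pairs drops its last vertex; J only needs to be independent.
    LYJ : List (Fin n)
    LYJ = map w LXJ ++ R

    module J = Configuration w LXJ LXJ-unique LYJ (images++-unique LXJ-unique R-unique (λ {i} _ → w∉R i))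

    J-independent : Independent 𝒯 J.tokenSet
    J-independent = J.independent w-injective (λ _ → w-free _)
      (pairs-compatible w LXJ R Xac-even (R-outside (λ _ → inj₂ refl)))

    module I (LY : List (Fin n)) (LY-unique : Unique LY) = Configuration (redirect a) Xac Xac-unique LY LY-unique

    I-independent : ∀ {LY} (LY-unique : Unique LY) → All (Compatible (redirect a)) (pairs LY) →
                    Independent 𝒯 (I.tokenSet LY LY-unique)
    I-independent {LY} LY-unique = I.independent LY LY-unique (redirect-injective a)
      (λ {i} i∈ → subst (Free B) (sym (redirect-else (λ i≡a → a∉Xac (subst (_∈ Xac) i≡a i∈)))) (w-free i))

    I-dominatesX : ∀ {i j} → i ∉ Xac → j ∉ Xac → i ≢ j → DominatesX (redirect a) i j
    I-dominatesX = pairwise-outside-two {R = DominatesX (redirect a)} swap outside-Xac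
      (inj₂ (subst (λ u → B c u ≡ true) (sym (redirect-at a)) Bcz))

    I<J : ∀ {LY} (LY-unique : Unique LY) → length LY ≤ length LYJ →
          length (I.tokenSet LY LY-unique) < length J.tokenSet
    I<J {LY} LY-unique LY≤LYJ = subst₂ _<_ (sym (I.length-tokenSet LY LY-unique)) (sym J.length-tokenSet)
      (+-monoʳ-< m (s≤s (+-monoʳ-≤ ⌊ length Xac /2⌋ (⌊n/2⌋-mono LY≤LYJ))))

    length-Xac+R : suc (suc (suc (length (map w Xac ++ R)))) ≡ n
    length-Xac+R = begin
      suc (suc (suc (length (map w Xac ++ R))))
        ≡⟨ cong (λ k → suc (suc (suc k))) (length-++ (map w Xac) {R}) ⟩
      suc (suc (suc (length (map w Xac) + length R)))
        ≡⟨ cong (λ k → suc (suc (suc k + length R))) (length-map w Xac) ⟩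
      suc (suc (suc (length Xac)) + length R)          ≡⟨ cong (λ k → suc (k + length R)) length-Xac ⟩
      suc (m + length R)                               ≡⟨ length-R ⟩
      n                                                ∎
      where open ≡-Reasoning

    module EvenN (n-even : parity n ≡ 0ℙ) where
      LY : List (Fin n)
      LY = map w Xac ++ w a ∷ R

      LY-unique : Unique LY
      LY-unique = images++-unique Xac-unique (unique-∷ (w∉R a) R-unique) λ {i} i∈ →
        λ { (here wi≡wa) → a∉Xac (subst (_∈ Xac) (w-injective wi≡wa) i∈) ; (there wi∈) → w∉R i wi∈ }

      length-LY : suc (length LY) ≡ length LYJ
      length-LY = cong suc (trans (length-++ (map w Xac))
                    (trans (+-suc _ _) (cong suc (sym (length-++ (map w Xac))))))

      outside-LY : ∀ {u} → u ∉ LY → u ≡ w c ⊎ u ≡ z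
      outside-LY {u} u∉ with classify u
      ... | inj₂ (inj₁ u≡z) = inj₂ u≡z
      ... | inj₂ (inj₂ u∈R) = ⊥-elim (u∉ (∈-++⁺ʳ _ (there u∈R)))
      ... | inj₁ (i , refl) with outside-Xac (u∉ ∘ ∈-++⁺ˡ ∘ ∈-map⁺ w)
      ...   | inj₁ refl = ⊥-elim (u∉ (∈-++⁺ʳ _ (here refl)))
      ...   | inj₂ refl = inj₁ refl

      I-maximal : MaximalIndependent 𝒯 (I.tokenSet LY LY-unique)
      I-maximal = I.maximal LY LY-unique
        (I-independent LY-unique (pairs-compatible (redirect a) Xac (w a ∷ R) Xac-even
          λ { (here refl) → redirect-outside-w a ; (there u∈R) → R-outside (redirect-values a) u∈R }))
        Xac-even (trans (cong parity (trans (cong suc length-LY) length-Xac+R)) n-even)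
        I-dominatesX
        (pairwise-outside-two {R = DominatesY (redirect a)} DominatesY-sym outside-LY
          (c , inj₁ (redirect-else (a≢c ∘ sym) , Bcz)))

      ¬wellCovered-even-even : ¬ WellCovered 𝒯
      ¬wellCovered-even-even =
        ¬wellCovered I-maximal J-independent (I<J LY-unique (≤-trans (n≤1+n _) (≤-reflexive length-LY)))

    module OddN (n-odd : parity n ≡ 1ℙ) where
      LY : List (Fin n)
      LY = z ∷ w a ∷ (map w Xac ++ R)

      LY-unique : Unique LY
      LY-unique =
        unique-∷ (λ { (here z≡wa) → w≢z a (sym z≡wa) ; (there z∈) → ∉-++⁺ z∉images z∉R z∈ })
          (unique-∷ (∉-++⁺ (∉-images a∉Xac) (w∉R a))
                    (images++-unique Xac-unique R-unique (λ {i} _ → w∉R i)))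

      outside-LY : ∀ {u} → u ∉ LY → u ≡ w c
      outside-LY {u} u∉ with classify u
      ... | inj₂ (inj₁ refl) = ⊥-elim (u∉ (here refl))
      ... | inj₂ (inj₂ u∈R) = ⊥-elim (u∉ (there (there (∈-++⁺ʳ _ u∈R))))
      ... | inj₁ (i , refl) with outside-Xac (u∉ ∘ there ∘ there ∘ ∈-++⁺ˡ ∘ ∈-map⁺ w)
      ...   | inj₁ refl = ⊥-elim (u∉ (there (here refl)))
      ...   | inj₂ refl = refl

      I-maximal : MaximalIndependent 𝒯 (I.tokenSet LY LY-unique)
      I-maximal = I.maximal LY LY-unique
        (I-independent LY-unique
          (redirect-compatible a ∷ pairs-compatible (redirect a) Xac R Xac-even (R-outside (redirect-values a))))
        Xac-even (odd-suc⇒even {length LY} (trans (cong parity length-Xac+R) n-odd))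
        I-dominatesX
        (pairwise-outside-one {R = DominatesY (redirect a)} outside-LY)

      ¬wellCovered-even-odd : ¬ WellCovered 𝒯
      ¬wellCovered-even-odd = ¬wellCovered I-maximal J-independent (I<J LY-unique ≤-refl)

    ¬wellCovered-even : ¬ WellCovered 𝒯
    ¬wellCovered-even with parity n in n-parity
    ... | 0ℙ = EvenN.¬wellCovered-even-even n-parity
    ... | 1ℙ = OddN.¬wellCovered-even-odd n-parity

  ¬wellCovered-𝒢 : (2 ∣ n) ⊎ (2 ∣ m) → ¬ WellCovered 𝒯
  ¬wellCovered-𝒢 n-or-m-even with parity m in m-parity
  ... | 0ℙ = let a , a≢c = another-element m-parity c in EvenCase.¬wellCovered-even m-parity a a≢c
  ... | 1ℙ = OddCase.¬wellCovered-odd m-parity n-even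
    where
    n-even : parity n ≡ 0ℙ
    n-even = [ 2∣⇒even , ⊥-elim ∘ odd⇒¬2∣ m-parity ] n-or-m-even

theorem6p6 : (m n : ℕ) (B : Fin m → Fin n → Bool) →
    1 ≤ m → m ≤ n →
    nbrCountY B ≤ n ∸ m →
    Connected (graphG m n B) →
    (2 ∣ n) ⊎ (2 ∣ m) →
    ¬ WellCovered (T₂ (graphG m n B) _≺_)
theorem6p6 m n B 1≤m m≤n few-neighbours connected =
  let c , z , Bcz = crossing-edge (connected (inj₁ (fromℕ< 1≤m)) (inj₂ (fromℕ< (≤-trans 1≤m m≤n))))
      w , w-injective , w-free = free-injection m≤n few-neighbours
  in ¬wellCovered-𝒢 B c z Bcz w w-injective w-free
  where open FreeVertices B
        open Construction using (¬wellCovered-𝒢)
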